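{- Let $O\subseteq\mathsf{I}\mathbb{R}$ be Scott-open. Then $O\cap\mathbb R$ is open in $\mathbb R$.
   Context: Work constructively; $\tilde\exists x.A$ abbreviates $\neg\forall x.\neg A$. $\mathsf{I}\mathbb{Q}=\{[p,q]\mid p,q\in\mathbb Q,\ p\le q\}$ ordered by $[p,q]\sqsubseteq[p',q']$ iff $p\le p'\le q'\le q$; $\ell([p,q])=q-p$. A chain is a sequence $(x_n)$ with $x_n\sqsubseteq x_{n+1}$; $\beta\ll\gamma$ means: for every chain $(x_n)$ whose supremum exists and satisfies $\gamma\sqsubseteq\bigsqcup_n x_n$, there weakly exists $n$ with $\beta\sqsubseteq x_n$. $\mathsf{I}\mathbb{R}$ is the set of increasing sequences $x=(x_n)=([\underline x_n,\overline x_n])_n$ in $\mathsf{I}\mathbb{Q}$, preordered by $(x_n)\sqsubseteq(y_n)$ iff for all $b\in\mathsf{I}\mathbb{Q}$, $n$, $b\ll x_n$ implies $\tilde\exists m.\,b\ll y_m$; equality is mutual $\sqsubseteq$. A subset $O$ of $\mathsf{I}\mathbb{R}$ is Scott-open if it is an upper set and whenever $(x_n)$ is a chain with $\bigsqcup_n x_n\in O$ there weakly exists $k$ with $x_k\in O$. A total real is $x\in\mathsf{I}\mathbb{R}$ with $\forall k.\,\tilde\exists n.\,\ell(x_n)\le2^{ -k}$; $\mathbb R$ is the set of total reals. Arithmetic on $\mathsf{I}\mathbb{Q}$: $a+b=[\underline a+\underline b,\overline a+\overline b]$, $-a=[-\overline a,-\underline a]$, $|a|=a$ if $0\le\underline a$,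 $[0,\max\{ -\underline a,\overline a\}]$ if $\underline a\le0\le\overline a$, $-a$ if $\overline a\le0$; extended pointwise to $\mathsf{I}\mathbb{R}$, with $x-y=x+(-y)$ and rationals $q$ identified with $([q,q])_n$. $0\le x$ iff $\forall k.\,\tilde\exists n.\,-2^{ -k}\le\underline x_n$; $x\le y$ iff $0\le y-x$. A set $U\subseteq\mathbb R$ is open if for all $x\in U$ there weakly exists $k\in\mathbb N$ such that every $y\in\mathbb R$ with $|x-y|\le2^{ -k}$ lies in $U$. -}

module Defs where

open import Data.Nat using (ℕ; zero; suc)
open import Data.Product using (Σ; _×_; _,_; proj₁; proj₂)
open import Data.Rational using (ℚ; _≤_; _+_; _-_; _*_; -_; _⊔_; 0ℚ; 1ℚ; ½)
open import Data.Rational.Properties using (_≤?_; +-mono-≤; neg-antimono-≤; ≰⇒>; <⇒≤; p≤q⇒p≤r⊔q; ≤-refl)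
open import Relation.Nullary using (¬_; yes; no)

∃̃ : {A : Set} → (A → Set) → Set
∃̃ {A} P = ¬ ((a : A) → ¬ P a)

2^-_ : ℕ → ℚ
2^- zero    = 1ℚ
2^- (suc k) = ½ * (2^- k)

record IQ : Set where
  constructor [_,_]⟨_⟩
  field
    lo  : ℚ
    hi  : ℚ
    lo≤hi : lo ≤ hi
open IQ public

infix 4 _⊑_ _≪_
_⊑_ : IQ → IQ → Set
a ⊑ b = (lo a ≤ lo b) × (hi b ≤ hi a)

ℓ : IQ → ℚ
ℓ a = hi a - lo a

IsChainIQ : (ℕ → IQ) → Set
IsChainIQ x = (n : ℕ) → x n ⊑ x (suc n)

IsSupIQ : (ℕ → IQ) → IQ → Set
IsSupIQ x s = ((n : ℕ) → x n ⊑ s) × ((u : IQ) → ((n : ℕ) → x n ⊑ u) → s ⊑ u)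

_≪_ : IQ → IQ → Set
β ≪ γ = (x : ℕ → IQ) → IsChainIQ x → (s : IQ) → IsSupIQ x s → γ ⊑ s →
        ∃̃ (λ n → β ⊑ x n)

record IR : Set where
  constructor mkIR
  field
    seq  : ℕ → IQ
    incr : IsChainIQ seq
open IR public

infix 4 _⊑R_
_⊑R_ : IR → IR → Set
x ⊑R y = (b : IQ) (n : ℕ) → b ≪ seq x n → ∃̃ (λ m → b ≪ seq y m)

IsChainIR : (ℕ → IR) → Set
IsChainIR c = (n : ℕ) → c n ⊑R c (suc n)

IsSupIR : (ℕ → IR) → IR → Set
IsSupIR c s = ((n : ℕ) → c n ⊑R s) × ((u : IR) → ((n : ℕ) → c n ⊑R u) → s ⊑R u)

IsUpperSet : (IR → Set) → Set
IsUpperSet O = (x y : IR) → x ⊑R y → O x → O y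

ScottOpen : (IR → Set) → Set
ScottOpen O = IsUpperSet O ×
  ((c : ℕ → IR) → IsChainIR c → (s : IR) → IsSupIR c s → O s → ∃̃ (λ k → O (c k)))

Total : IR → Set
Total x = (k : ℕ) → ∃̃ (λ n → ℓ (seq x n) ≤ 2^- k)

ℝ : Set
ℝ = Σ IR Total

infixl 6 _+I_ _-I_
_+I_ : IQ → IQ → IQ
a +I b = [ lo a + lo b , hi a + hi b ]⟨ +-mono-≤ (lo≤hi a) (lo≤hi b) ⟩

-I_ : IQ → IQ
-I a = [ - hi a , - lo a ]⟨ neg-antimono-≤ (lo≤hi a) ⟩

_-I_ : IQ → IQ → IQ
a -I b = a +I (-I b)

∣_∣I : IQ → IQ
∣ a ∣I with 0ℚ ≤? lo a
... | yes _ = a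
... | no _ with hi a ≤? 0ℚ
...   | yes _ = -I a
...   | no h  = [ 0ℚ , (- lo a) ⊔ hi a ]⟨ p≤q⇒p≤r⊔q (- lo a) (<⇒≤ (≰⇒> h)) ⟩

const : ℚ → IQ
const q = [ q , q ]⟨ ≤-refl ⟩

Seq : Set
Seq = ℕ → IQ

infixl 6 _+S_ _-S_
_+S_ : Seq → Seq → Seq
(x +S y) n = x n +I y n

-S_ : Seq → Seq
(-S x) n = -I x n

_-S_ : Seq → Seq → Seq
x -S y = x +S (-S y)

∣_∣S : Seq → Seq
∣ x ∣S n = ∣ x n ∣I

constS : ℚ → Seq
constS q n = const q

0≤S : Seq → Set
0≤S x = (k : ℕ) → ∃̃ (λ n → - (2^- k) ≤ lo (x n))

infix 4 _≤S_
_≤S_ : Seq → Seq → Set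
x ≤S y = 0≤S (y -S x)

IsOpenℝ : (ℝ → Set) → Set
IsOpenℝ U = (x : ℝ) → U x →
  ∃̃ (λ (k : ℕ) → (y : ℝ) → ∣ seq (proj₁ x) -S seq (proj₁ y) ∣S ≤S constS (2^- k) → U y)

module Submission where

-- Widening every interval of x ∈ IR by 2^-k on both sides gives an
-- element x↑k of IR, and (x↑k)_k is a chain with supremum x: each widened
-- interval is way below the next one (it contains it in its interior), and
-- the widened intervals shrink to x_m by the Archimedean property of 2^-k.
-- If x ∈ O and O is Scott-open, then weakly some x↑k lies in O.  Any y with
-- |x - y| ≤ 2^-(k+1) has, weakly, an interval y_n within 2^-k of x_n, so
-- every widened interval of x↑k lies below y_n; hence x↑k ⊑ y, and y ∈ O
-- because O is an upper set.

open import Defs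
open import Data.Empty using (⊥-elim)
open import Data.Integer using (+_; +[1+_]; +≤+)
open import Data.Nat as ℕ using (ℕ; zero; suc; z≤n; s≤s; _≤′_; ≤′-refl; ≤′-step; _⊔_)
import Data.Nat.Properties as ℕP
open import Data.Product using (proj₁; proj₂; _,_)
open import Data.Rational
  using (ℚ; mkℚ; _≤_; _<_; _+_; _-_; -_; 0ℚ; ½; Positive; positive; toℚᵘ)
open import Data.Rational.Properties
  using ( ≤-refl; ≤-trans; <⇒≤; ≰⇒>; <-irrefl; <-≤-trans; ≤-<-trans; _≤?_
        ; +-monoˡ-≤; +-monoʳ-≤; +-monoʳ-<; +-identityˡ; +-identityʳ
        ; neg-antimono-≤; neg-antimono-<; positive⁻¹; pos*pos⇒pos; p≤p⊔q; p≤q⊔p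
        ; toℚᵘ-mono-≤; toℚᵘ-homo-*; module ≤-Reasoning )
open import Data.Rational.Solver using (module +-*-Solver)
import Data.Rational.Unnormalised as ℚᵘ
import Data.Rational.Unnormalised.Properties as ℚᵘP
open import Function using (id)
open import Relation.Binary.PropositionalEquality using (_≡_; refl; subst)
open import Relation.Nullary using (¬_; yes; no)

open +-*-Solver

∃̃-intro : {A : Set} {P : A → Set} (a : A) → P a → ∃̃ P
∃̃-intro a pa ¬P = ¬P a pa

∃̃-map : {A B : Set} {P : A → Set} {Q : B → Set} (f : A → B) →
        ((a : A) → P a → Q (f a)) → ∃̃ P → ∃̃ Q
∃̃-map f g ∃P ¬Q = ∃P (λ a pa → ¬Q (f a) (g a pa))

∃̃-bind : {A B : Set} {P : A → Set} {Q : B → Set} →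
         ∃̃ P → ((a : A) → P a → ∃̃ Q) → ∃̃ Q
∃̃-bind ∃P g ¬Q = ∃P (λ a pa → g a pa ¬Q)

module _ where
  open ≤-Reasoning

  ≤-+-nonNeg : ∀ a {t} → 0ℚ ≤ t → a ≤ a + t
  ≤-+-nonNeg a {t} 0≤t = begin
    a      ≡⟨ +-identityʳ a ⟨
    a + 0ℚ ≤⟨ +-monoʳ-≤ a 0≤t ⟩
    a + t  ∎

  -nonNeg-≤ : ∀ a {t} → 0ℚ ≤ t → a - t ≤ a
  -nonNeg-≤ a {t} 0≤t = begin
    a - t    ≤⟨ +-monoʳ-≤ a (neg-antimono-≤ 0≤t) ⟩
    a + - 0ℚ ≡⟨ +-identityʳ a ⟩
    a        ∎

  -≤⇒≤+ : ∀ a b t → a - t ≤ b → a ≤ b + t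
  -≤⇒≤+ a b t h = begin
    a           ≡⟨ solve 2 (λ a t → a := (a :- t) :+ t) refl a t ⟩
    (a - t) + t ≤⟨ +-monoˡ-≤ t h ⟩
    b + t       ∎

  ≤+⇒-≤ : ∀ a b t → a ≤ b + t → a - b ≤ t
  ≤+⇒-≤ a b t h = begin
    a - b       ≤⟨ +-monoˡ-≤ (- b) h ⟩
    (b + t) - b ≡⟨ solve 2 (λ b t → (b :+ t) :- b := t) refl b t ⟩
    t           ∎

  -≤0⇒≤ : ∀ a b → a - b ≤ 0ℚ → a ≤ b
  -≤0⇒≤ a b h = begin
    a      ≤⟨ -≤⇒≤+ a 0ℚ b h ⟩
    0ℚ + b ≡⟨ +-identityˡ b ⟩
    b      ∎

  -≤-⇒≤+ : ∀ ε h → - ε ≤ ε - h → h ≤ ε + ε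
  -≤-⇒≤+ ε h le = begin
    h                  ≡⟨ solve 2 (λ ε h → h := (:- ε :+ ε) :+ h) refl ε h ⟩
    (- ε + ε) + h      ≤⟨ +-monoˡ-≤ h (+-monoˡ-≤ ε le) ⟩
    ((ε - h) + ε) + h  ≡⟨ solve 2 (λ ε h → ((ε :- h) :+ ε) :+ h := ε :+ ε) refl ε h ⟩
    ε + ε              ∎

  diff≤⇒-≤ : ∀ p q ε → p - q ≤ ε → p - ε ≤ q
  diff≤⇒-≤ p q ε h = begin
    p - ε             ≡⟨ solve 3 (λ p q ε → p :- ε := (p :- q) :+ (q :- ε)) refl p q ε ⟩
    (p - q) + (q - ε) ≤⟨ +-monoˡ-≤ (q - ε) h ⟩
    ε + (q - ε)       ≡⟨ solve 2 (λ q ε → ε :+ (q :- ε) := q) refl q ε ⟩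
    q                 ∎

  neg-diff≤⇒≤+ : ∀ p q ε → - (p - q) ≤ ε → q ≤ p + ε
  neg-diff≤⇒≤+ p q ε h = begin
    q             ≡⟨ solve 2 (λ p q → q := p :+ :- (p :- q)) refl p q ⟩
    p + - (p - q) ≤⟨ +-monoʳ-≤ p h ⟩
    p + ε         ∎

2^-positive : ∀ k → Positive (2^- k)
2^-positive zero    = _
2^-positive (suc k) = pos*pos⇒pos ½ (2^- k) {{2^-positive k}}

2^-pos : ∀ k → 0ℚ < 2^- k
2^-pos k = positive⁻¹ (2^- k) {{2^-positive k}}

2^-nonNeg : ∀ k → 0ℚ ≤ 2^- k
2^-nonNeg k = <⇒≤ (2^-pos k)

2^-halves : ∀ k → 2^- (suc k) + 2^- (suc k) ≡ 2^- k
2^-halves k = solve 1 (λ t → (con ½ :* t) :+ (con ½ :* t) := t) refl (2^- k)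

2^-suc< : ∀ k → 2^- (suc k) < 2^- k
2^-suc< k = begin-strict
  2^- (suc k)                ≡⟨ +-identityʳ (2^- (suc k)) ⟨
  2^- (suc k) + 0ℚ           <⟨ +-monoʳ-< (2^- (suc k)) (2^-pos (suc k)) ⟩
  2^- (suc k) + 2^- (suc k)  ≡⟨ 2^-halves k ⟩
  2^- k                      ∎
  where open ≤-Reasoning

-- Archimedean property.  In unnormalised form 2^-j is 1 / (pred2^ j + 1)
-- with pred2^ j = 2^j − 1; the recursion for pred2^ is chosen so that this
-- holds by computation of ℚᵘ multiplication.

pred2^ : ℕ → ℕ
pred2^ zero    = 0
pred2^ (suc j) = pred2^ j ℕ.+ suc (pred2^ j ℕ.+ 0)

pred2^-≥ : ∀ j → j ℕ.≤ pred2^ j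
pred2^-≥ zero    = z≤n
pred2^-≥ (suc j) = ℕP.≤-trans (s≤s (ℕP.≤-trans (pred2^-≥ j) (ℕP.m≤m+n (pred2^ j) 0)))
                              (ℕP.m≤n+m (suc (pred2^ j ℕ.+ 0)) (pred2^ j))

2^-≃ : ∀ j → toℚᵘ (2^- j) ℚᵘ.≃ ℚᵘ.mkℚᵘ (+ 1) (pred2^ j)
2^-≃ zero    = ℚᵘP.≃-refl
2^-≃ (suc j) = ℚᵘP.≃-trans (toℚᵘ-homo-* ½ (2^- j)) (ℚᵘP.*-congˡ {toℚᵘ ½} (2^-≃ j))

-- A positive rational n/d is not below 2^-(d+1) = 1/2^(d+1).
positive-not-below-2^- : ∀ e → Positive e → ¬ (∀ j → e ≤ 2^- j)
positive-not-below-2^- (mkℚ +[1+ n ] d _) _ below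
  with ℚᵘP.≤-respʳ-≃ (2^-≃ (suc d)) (toℚᵘ-mono-≤ (below (suc d)))
... | ℚᵘ.*≤* (+≤+ n·2^d≤d) = ℕP.<-irrefl refl (begin-strict
  suc d                          <⟨ s≤s (pred2^-≥ (suc d)) ⟩
  suc (pred2^ (suc d))           ≤⟨ ℕP.m≤n*m (suc (pred2^ (suc d))) (suc n) ⟩
  suc n ℕ.* suc (pred2^ (suc d)) ≤⟨ n·2^d≤d ⟩
  1 ℕ.* suc d                    ≡⟨ ℕP.*-identityˡ (suc d) ⟩
  suc d                          ∎)
  where open ℕP.≤-Reasoning

≤-+2^-⇒≤ : ∀ a b → (∀ j → a ≤ b + 2^- j) → a ≤ b
≤-+2^-⇒≤ a b close = -≤0⇒≤ a b (nonPos (a - b) (λ j → ≤+⇒-≤ a b (2^- j) (close j)))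
  where
  nonPos : ∀ e → (∀ j → e ≤ 2^- j) → e ≤ 0ℚ
  nonPos e below with e ≤? 0ℚ
  ... | yes e≤0 = e≤0
  ... | no  e≰0 = ⊥-elim (positive-not-below-2^- e (positive (≰⇒> e≰0)) below)

⊑-refl : ∀ a → a ⊑ a
⊑-refl _ = ≤-refl , ≤-refl

⊑-trans : ∀ a b c → a ⊑ b → b ⊑ c → a ⊑ c
⊑-trans _ _ _ (lo≤ , ≤hi) (lo≤′ , ≤hi′) = ≤-trans lo≤ lo≤′ , ≤-trans ≤hi′ ≤hi

chain-⊑ : ∀ z → IsChainIQ z → ∀ {m n} → m ℕ.≤ n → z m ⊑ z n
chain-⊑ z chain {m} m≤n = go (ℕP.≤⇒≤′ m≤n)
  where
  go : ∀ {n} → m ≤′ n → z m ⊑ z n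
  go ≤′-refl            = ⊑-refl (z m)
  go (≤′-step {n} m≤n) = ⊑-trans (z m) (z n) (z (suc n)) (go m≤n) (chain n)

-- Any two members of a chain overlap: both contain the later one.
chain-overlap : ∀ z → IsChainIQ z → ∀ m n → lo (z m) ≤ hi (z n)
chain-overlap z chain m n =
  ≤-trans (proj₁ (chain-⊑ z chain (ℕP.m≤m⊔n m n)))
          (≤-trans (lo≤hi (z (m ⊔ n))) (proj₂ (chain-⊑ z chain (ℕP.m≤n⊔m m n))))

≪-⊑-trans : ∀ b a a′ → b ≪ a → a ⊑ a′ → b ≪ a′
≪-⊑-trans b a a′ b≪a a⊑a′ z chain s sup a′⊑s = b≪a z chain s sup (⊑-trans a a′ s a⊑a′ a′⊑s)

⊑-≪-trans : ∀ b a a′ → b ⊑ a → a ≪ a′ → b ≪ a′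
⊑-≪-trans b a a′ b⊑a a≪a′ z chain s sup a′⊑s =
  ∃̃-map id (λ n a⊑zn → ⊑-trans b a (z n) b⊑a a⊑zn) (a≪a′ z chain s sup a′⊑s)

-- Comparing the supremum s of a chain z with the upper bounds [q, hi s]
-- and [lo s, q]: bounds on all endpoints of z transfer to s.

sup-lo-≤ : ∀ z s → IsSupIQ z s → ∀ q → q ≤ hi s → (∀ n → lo (z n) ≤ q) → lo s ≤ q
sup-lo-≤ z s (upper , least) q q≤hi below =
  proj₁ (least [ q , hi s ]⟨ q≤hi ⟩ (λ n → below n , proj₂ (upper n)))

sup-hi-≥ : ∀ z s → IsSupIQ z s → ∀ q → lo s ≤ q → (∀ n → q ≤ hi (z n)) → q ≤ hi s
sup-hi-≥ z s (upper , least) q lo≤q above =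
  proj₂ (least [ lo s , q ]⟨ lo≤q ⟩ (λ n → proj₁ (upper n) , above n))

-- Suppose no
-- member of the chain refines a.  Then every lower endpoint stays ≤ lo a:
-- otherwise, from that point on, the upper endpoints stay ≥ hi a (again
-- since a is never refined), forcing hi a ≤ hi s ≤ hi a′ < hi a.  But then
-- lo a < lo a′ ≤ lo s ≤ lo a.
interior⇒≪ : ∀ a a′ → lo a < lo a′ → hi a′ < hi a → a ≪ a′
interior⇒≪ a a′ lo< <hi z chain s sup (lo′≤ , ≤hi′) a⋢z =
  <-irrefl refl (<-≤-trans lo< (≤-trans lo′≤ (sup-lo-≤ z s sup (lo a) lo-a≤hi-s lo-below)))
  where
  lo-a≤hi-s : lo a ≤ hi s
  lo-a≤hi-s = ≤-trans (<⇒≤ lo<) (≤-trans lo′≤ (lo≤hi s))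

  lo-below : ∀ n → lo (z n) ≤ lo a
  lo-below n with lo a ≤? lo (z n)
  ... | no  a≰zn = <⇒≤ (≰⇒> a≰zn)
  ... | yes a≤zn = ⊥-elim (<-irrefl refl
          (≤-<-trans (≤-trans (sup-hi-≥ z s sup (hi a) lo-s≤hi-a hi-above) ≤hi′) <hi))
    where
    lo-s≤hi-a : lo s ≤ hi a
    lo-s≤hi-a = ≤-trans (lo≤hi s) (≤-trans ≤hi′ (<⇒≤ <hi))

    hi-above : ∀ m → hi a ≤ hi (z m)
    hi-above m with hi (z m) ≤? hi a
    ... | no  zm≰a = <⇒≤ (≰⇒> zm≰a)
    ... | yes zm≤a = ⊥-elim (a⋢z (m ⊔ n)
            ( ≤-trans a≤zn (proj₁ (chain-⊑ z chain (ℕP.m≤n⊔m m n)))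
            , ≤-trans (proj₂ (chain-⊑ z chain (ℕP.m≤m⊔n m n))) zm≤a ))

widen : (a : IQ) (ε : ℚ) → 0ℚ ≤ ε → IQ
widen a ε 0≤ε =
  [ lo a - ε , hi a + ε ]⟨ ≤-trans (-nonNeg-≤ (lo a) 0≤ε) (≤-trans (lo≤hi a) (≤-+-nonNeg (hi a) 0≤ε)) ⟩

widen-⊑ : ∀ a {ε} (0≤ε : 0ℚ ≤ ε) → widen a ε 0≤ε ⊑ a
widen-⊑ a 0≤ε = -nonNeg-≤ (lo a) 0≤ε , ≤-+-nonNeg (hi a) 0≤ε

widen-mono : ∀ a b {ε} (0≤ε : 0ℚ ≤ ε) → a ⊑ b → widen a ε 0≤ε ⊑ widen b ε 0≤ε
widen-mono _ _ {ε} _ (lo≤ , ≤hi) = +-monoˡ-≤ (- ε) lo≤ , +-monoˡ-≤ ε ≤hi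

widen-antitone : ∀ a {ε ε′} (0≤ε : 0ℚ ≤ ε) (0≤ε′ : 0ℚ ≤ ε′) →
                 ε′ ≤ ε → widen a ε 0≤ε ⊑ widen a ε′ 0≤ε′
widen-antitone a _ _ ε′≤ε = +-monoʳ-≤ (lo a) (neg-antimono-≤ ε′≤ε) , +-monoʳ-≤ (hi a) ε′≤ε

-- Shrinking the tolerance strictly moves both endpoints strictly inwards.
widen-≪ : ∀ a {ε ε′} (0≤ε : 0ℚ ≤ ε) (0≤ε′ : 0ℚ ≤ ε′) →
          ε′ < ε → widen a ε 0≤ε ≪ widen a ε′ 0≤ε′
widen-≪ a 0≤ε 0≤ε′ ε′<ε = interior⇒≪ (widen a _ 0≤ε) (widen a _ 0≤ε′)
  (+-monoʳ-< (lo a) (neg-antimono-< ε′<ε)) (+-monoʳ-< (hi a) ε′<ε)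

approx : IQ → ℕ → IQ
approx a k = widen a (2^- k) (2^-nonNeg k)

approx-chain : ∀ a → IsChainIQ (approx a)
approx-chain a k = widen-antitone a (2^-nonNeg k) (2^-nonNeg (suc k)) (<⇒≤ (2^-suc< k))

approx-≪ : ∀ a k → approx a k ≪ approx a (suc k)
approx-≪ a k = widen-≪ a (2^-nonNeg k) (2^-nonNeg (suc k)) (2^-suc< k)

approx-sup : ∀ a → IsSupIQ (approx a) a
approx-sup a = (λ k → widen-⊑ a (2^-nonNeg k))
             , λ u upper → ≤-+2^-⇒≤ (lo a) (lo u) (λ j → -≤⇒≤+ (lo a) (lo u) (2^- j) (proj₁ (upper j)))
                         , ≤-+2^-⇒≤ (hi u) (hi a) (λ j → proj₂ (upper j))

hi≤hi∣∣ : ∀ a → hi a ≤ hi ∣ a ∣I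
hi≤hi∣∣ a with 0ℚ ≤? lo a
... | yes _ = ≤-refl
... | no 0≰lo with hi a ≤? 0ℚ
...   | yes hi≤0 = ≤-trans hi≤0 (neg-antimono-≤ (<⇒≤ (≰⇒> 0≰lo)))
...   | no  _    = p≤q⊔p (- lo a) (hi a)

-lo≤hi∣∣ : ∀ a → - lo a ≤ hi ∣ a ∣I
-lo≤hi∣∣ a with 0ℚ ≤? lo a
... | yes 0≤lo = ≤-trans (neg-antimono-≤ 0≤lo) (≤-trans 0≤lo (lo≤hi a))
... | no _ with hi a ≤? 0ℚ
...   | yes _ = ≤-refl
...   | no  _ = p≤p⊔q (- lo a) (hi a)

close⇒widen-⊑ : ∀ a b c {ε} (0≤ε : 0ℚ ≤ ε) → hi ∣ a -I b ∣I ≤ ε →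
                lo c ≤ hi a → lo a ≤ hi c → widen c ε 0≤ε ⊑ b
close⇒widen-⊑ a b c {ε} _ close lo-c≤hi-a lo-a≤hi-c =
    ≤-trans (+-monoˡ-≤ (- ε) lo-c≤hi-a)
            (diff≤⇒-≤ (hi a) (lo b) ε (≤-trans (hi≤hi∣∣ (a -I b)) close))
  , ≤-trans (neg-diff≤⇒≤+ (lo a) (hi b) ε (≤-trans (-lo≤hi∣∣ (a -I b)) close))
            (+-monoˡ-≤ ε lo-a≤hi-c)

≤S-2^-⇒hi≤ : ∀ (d : Seq) k → d ≤S constS (2^- (suc k)) → ∃̃ (λ n → hi (d n) ≤ 2^- k)
≤S-2^-⇒hi≤ d k d≤ = ∃̃-map id
  (λ n le → subst (hi (d n) ≤_) (2^-halves k) (-≤-⇒≤+ (2^- (suc k)) (hi (d n)) le))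
  (d≤ (suc k))

⊑R-intro : ∀ x y → (∀ m → ∃̃ (λ n → seq x m ⊑ seq y n)) → x ⊑R y
⊑R-intro x y refined b m b≪xm =
  ∃̃-map id (λ n xm⊑yn → ≪-⊑-trans b (seq x m) (seq y n) b≪xm xm⊑yn) (refined m)

⊑R-pointwise : ∀ x y → (∀ m → seq x m ⊑ seq y m) → x ⊑R y
⊑R-pointwise x y refined = ⊑R-intro x y (λ m → ∃̃-intro m (refined m))

widenR : IR → ℕ → IR
widenR x k = mkIR (λ m → approx (seq x m) k) (λ m → widen-mono (seq x m) (seq x (suc m)) (2^-nonNeg k) (incr x m))

widenR-chain : ∀ x → IsChainIR (widenR x)
widenR-chain x k = ⊑R-pointwise (widenR x k) (widenR x (suc k)) (λ m → approx-chain (seq x m) k)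

-- It bounds them pointwise; and if u bounds
-- them, then anything way below x_n is weakly below some approx (x_n) j,
-- hence way below approx (x_n) (j+1), an interval of x↑(j+1) ⊑R u.
widenR-sup : ∀ x → IsSupIR (widenR x) x
widenR-sup x = (λ k → ⊑R-pointwise (widenR x k) x (λ m → widen-⊑ (seq x m) (2^-nonNeg k)))
             , least
  where
  least : (u : IR) → ((k : ℕ) → widenR x k ⊑R u) → x ⊑R u
  least u bounds b n b≪xn = ∃̃-bind
    (b≪xn (approx xn) (approx-chain xn) xn (approx-sup xn) (⊑-refl xn))
    (λ j b⊑ → bounds (suc j) b n (⊑-≪-trans b (approx xn j) (approx xn (suc j)) b⊑ (approx-≪ xn j)))
    where xn = seq x n

near⇒widenR-⊑R : ∀ x y k → ∣ seq x -S seq y ∣S ≤S constS (2^- (suc k)) → widenR x k ⊑R y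
near⇒widenR-⊑R x y k near = ⊑R-intro (widenR x k) y λ m →
  ∃̃-map id (λ n close → close⇒widen-⊑ (seq x n) (seq y n) (seq x m) (2^-nonNeg k) close
                           (chain-overlap (seq x) (incr x) m n) (chain-overlap (seq x) (incr x) n m))
           (≤S-2^-⇒hi≤ ∣ seq x -S seq y ∣S k near)

lemma8p2 : (O : IR → Set) → ScottOpen O → IsOpenℝ (λ x → O (proj₁ x))
lemma8p2 O (upper , scott) (x , _) x∈O =
  ∃̃-map suc (λ k x↑k∈O (y , _) near → upper (widenR x k) y (near⇒widenR-⊑R x y k near) x↑k∈O)
            (scott (widenR x) (widenR-chain x) x (widenR-sup x) x∈O)
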